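{- Let $A_1,\dots,A_n$ be finite multisets (of elements of some set) and $A=A_1\cup\cdots\cup A_n$. Then for every reduced forest $F$ with leaves in $A$, $$\sum_{c\in\mathcal{C}_F}(-1)^{|c|}=\begin{cases}(-1)^{w_F}&\text{if }F\text{ is mixing},\\ 0&\text{otherwise.}\end{cases}$$
   Context: Elements of $A$ are regarded as distinguishable (indexed), each belonging to a specified $A_i$. A reduced forest with leaves in $A$ is a finite forest of rooted trees with unordered children whose leaves (vertices without children; a one-vertex tree is a single leaf) are labelled bijectively by the elements of $A$, every non-leaf vertex having at least two children. $F$ is mixing if for every vertex all of whose children are leaves, those children are labelled by elements belonging to at least two distinct multisets $A_i\ne A_j$; then $w_F$ = (number of vertices of $F$) $-$ (number of leaves). A gap-free colouring of $F$ of length $r\ge0$ is a map $c$ from the vertices of $F$ to $\{0,1,\dots,r\}$ such that every colour $0,\dots,r$ is used, every leaf has colour $0$, and colours strictly decrease from a vertex to each of its children; $|c|:=r$. It is weakly-mixing if either some vertex of colour $1$ has two children labelled by elements belonging to two distinct multisets $A_i\ne A_j$, or colour $1$ is not used. $\mathcal{C}_F$ denotes the set of gap-free weakly-mixing colourings of $F$. -}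

module Defs where

open import Data.Nat using (ℕ; zero; suc; _∸_)
open import Data.Fin using (Fin; toℕ) renaming (_<_ to _<ᶠ_)
open import Data.Fin.Properties using (any?; all?; _≟_)
open import Data.Maybe using (Maybe; just; nothing; _>>=_)
open import Data.Maybe.Properties using (≡-dec)
open import Data.Product using (Σ; ∃; ∃-syntax; _×_; _,_)
open import Data.Sum using (_⊎_)
open import Data.List using (List; []; _∷_; map; concatMap; filter; length)
open import Data.List.Base using (upTo)
open import Data.Vec.Functional using () renaming (_∷_ to _∷ᶠ_)
open import Data.Integer using (ℤ; +_; _+_; _*_; -1ℤ; _^_)
open import Relation.Binary.PropositionalEquality using (_≡_; _≢_)
open import Relation.Nullary using (¬_; Dec; yes; no)
open import Relation.Nullary.Decidable using (_×-dec_; _⊎-dec_; _→-dec_; ¬?)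
import Data.Nat.Properties as ℕP
import Data.Fin as F
import Data.List

-- Set-up: the elements of A = A₁ ∪ ⋯ ∪ Aₙ are the (distinguishable)
-- indices  a : Fin m ; the multiset containing a is  lab a : Fin n.

-- A forest on the vertex set Fin v, given by a parent map
-- (nothing = root).  k-fold ancestor:
anc : ∀ {v} → (Fin v → Maybe (Fin v)) → ℕ → Fin v → Maybe (Fin v)
anc p zero    x = just x
anc p (suc k) x = anc p k x >>= p

IsLeaf : ∀ {v} → (Fin v → Maybe (Fin v)) → Fin v → Set
IsLeaf p x = ∀ y → p y ≢ just x

record Forest (m : ℕ) : Set where
  field
    v       : ℕ
    parent  : Fin v → Maybe (Fin v)
    -- no cycles: after v steps one has left the forest through a root
    acyclic : ∀ x → anc parent v x ≡ nothing
    leafOf      : Fin m → Fin v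
    leafOf-inj  : ∀ a b → leafOf a ≡ leafOf b → a ≡ b
    leafOf-leaf : ∀ a → IsLeaf parent (leafOf a)
    leafOf-onto : ∀ x → IsLeaf parent x → ∃[ a ] leafOf a ≡ x
    reduced : ∀ x → ¬ IsLeaf parent x →
              ∃[ y ] ∃[ z ] (y ≢ z × parent y ≡ just x × parent z ≡ just x)

allFuns : (v k : ℕ) → List (Fin v → Fin k)
allFuns zero    k = (λ ()) ∷ []
allFuns (suc v) k = concatMap (λ i → map (λ f → i ∷ᶠ f) (allFuns v k)) (Data.List.allFin k)

sumℤ : List ℤ → ℤ
sumℤ []       = + 0
sumℤ (x ∷ xs) = x + sumℤ xs

module _ {m n : ℕ} (lab : Fin m → Fin n) (F : Forest m) where
  open Forest F

  MixedChildren : Fin v → Set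
  MixedChildren x = ∃[ a ] ∃[ b ]
    (parent (leafOf a) ≡ just x × parent (leafOf b) ≡ just x × lab a ≢ lab b)

  Mixing : Set
  Mixing = ∀ x → ¬ IsLeaf parent x →
           (∀ y → parent y ≡ just x → IsLeaf parent y) → MixedChildren x

  -- w_F = #vertices − #leaves
  w : ℕ
  w = v ∸ m

  GapFree : (r : ℕ) → (Fin v → Fin (suc r)) → Set
  GapFree r c = ∀ j → ∃[ x ] c x ≡ j

  LeavesZero : (r : ℕ) → (Fin v → Fin (suc r)) → Set
  LeavesZero r c = ∀ x → IsLeaf parent x → toℕ (c x) ≡ 0

  Decreasing : (r : ℕ) → (Fin v → Fin (suc r)) → Set
  Decreasing r c = ∀ x y → parent y ≡ just x → c y <ᶠ c x

  WeaklyMixing : (r : ℕ) → (Fin v → Fin (suc r)) → Set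
  WeaklyMixing r c = (∃[ x ] (toℕ (c x) ≡ 1 × MixedChildren x))
                     ⊎ (∀ x → toℕ (c x) ≢ 1)

  InC : (r : ℕ) → (Fin v → Fin (suc r)) → Set
  InC r c = GapFree r c × LeavesZero r c × Decreasing r c × WeaklyMixing r c

  isLeaf? : ∀ x → Dec (IsLeaf parent x)
  isLeaf? x = all? (λ y → ¬? (≡-dec _≟_ (parent y) (just x)))

  mixedChildren? : ∀ x → Dec (MixedChildren x)
  mixedChildren? x = any? λ a → any? λ b →
    ≡-dec _≟_ (parent (leafOf a)) (just x) ×-dec
    (≡-dec _≟_ (parent (leafOf b)) (just x) ×-dec ¬? (lab a ≟ lab b))

  inC? : ∀ r c → Dec (InC r c)
  inC? r c =
    all? (λ j → any? (λ x → c x ≟ j)) ×-dec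
    (all? (λ x → isLeaf? x →-dec (toℕ (c x) ℕP.≟ 0)) ×-dec
    (all? (λ x → all? (λ y → ≡-dec _≟_ (parent y) (just x) →-dec (c y F.<? c x))) ×-dec
    ((any? (λ x → (toℕ (c x) ℕP.≟ 1) ×-dec mixedChildren? x)
      ⊎-dec all? (λ x → ¬? (toℕ (c x) ℕP.≟ 1))))))

  -- Σ_{c ∈ 𝒞_F} (-1)^{|c|}.  A gap-free colouring of length r is a
  -- surjection Fin v → Fin (suc r), so necessarily r < v; the sum over
  -- r ∈ {0,…,v} therefore ranges over all of 𝒞_F.
  signedSum : ℤ
  signedSum = sumℤ (map (λ r → (+ length (filter (inC? r) (allFuns v (suc r)))) * (-1ℤ ^ r))
                        (upTo (suc v)))

module Submission where

-- Colourings are treated as ℕ-valued maps on the vertices.  For a nonempty set Z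
-- of vertices, call c admissible of length r if it is onto {0,…,r}, vanishes exactly
-- on Z, and strictly decreases along edges outside Z.  The main counting theorem
-- (signed-count) says that Σ_c (-1)^r over admissible c is (-1)^{#vertices outside Z}.
-- Proof: choose z ∉ Z with all children in Z.  Giving z a fresh colour just above
-- its own (split) is a bijection from the colourings of length r where z shares
-- its colour onto those of length r+1 where z is alone with colour ≥ 2, so these
-- cancel.  The survivors (z alone at colour 1) become, after lowering all colours by
-- one, the admissible colourings for Z ∪ {z}: the sign flips and induction applies.
-- For F, 𝒞_F consists of the leaf-admissible, weakly mixing colourings.  If F is
-- mixing, weak mixing is automatic and there are w_F non-leaves.  Otherwise some
-- inner vertex z with only leaf children is unmixed; the same involution at z then
-- preserves weak mixing and no survivor is weakly mixing, so everything cancels.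

open import Defs
open import Data.Nat using (ℕ; _<_)
open import Data.Fin using (Fin)
open import Data.Maybe using (Maybe; just; nothing)
open import Data.Integer using (-1ℤ; _^_; +_)
open import Data.Product using (_×_; _,_)
open import Relation.Nullary using (¬_)
open import Relation.Binary.PropositionalEquality using (_≡_)

module Counting where

  open import Data.Nat using (zero; suc; _+_; _*_; _≟_)
  import Data.Nat.Properties as ℕP
  open import Data.Fin using (toℕ; fromℕ<) renaming (zero to fz; suc to fs)
  open import Data.Fin.Properties using (all?; toℕ<n; toℕ-fromℕ<; toℕ-injective; suc-injective) renaming (_≟_ to _≟F_)
  open import Data.List using (List; []; _∷_; map; concatMap; filter; length; _++_; tabulate; allFin)
  open import Data.Vec.Functional using () renaming (_∷_ to _∷ᶠ_)
  open import Data.Product using (proj₁; proj₂)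
  open import Data.Sum using (_⊎_; inj₁; inj₂)
  open import Data.Empty using (⊥-elim)
  open import Relation.Binary.PropositionalEquality
  open import Relation.Nullary using (Dec; yes; no)
  open import Relation.Nullary.Decidable using (_×-dec_)
  open import Relation.Unary using (Decidable)
  open import Algebra.Properties.CommutativeSemigroup ℕP.+-commutativeSemigroup using (interchange)
  open import Algebra.Properties.CommutativeMonoid.Sum ℕP.+-0-commutativeMonoid
    using (sum-syntax; sum-cong-≗; sum-replicate-zero)

  𝟙 : ∀ {P : Set} → Dec P → ℕ
  𝟙 (yes _) = 1
  𝟙 (no _)  = 0

  𝟙-yes : ∀ {P : Set} → P → (p : Dec P) → 𝟙 p ≡ 1
  𝟙-yes _ (yes _) = refl
  𝟙-yes p (no ¬p) = ⊥-elim (¬p p)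

  𝟙-no : ∀ {P : Set} → ¬ P → (p : Dec P) → 𝟙 p ≡ 0
  𝟙-no ¬p (yes p) = ⊥-elim (¬p p)
  𝟙-no _  (no _)  = refl

  𝟙-cong : ∀ {P Q : Set} → (P → Q) → (Q → P) → (p : Dec P) (q : Dec Q) → 𝟙 p ≡ 𝟙 q
  𝟙-cong f g (yes p) q = sym (𝟙-yes (f p) q)
  𝟙-cong f g (no ¬p) q = sym (𝟙-no (λ q → ¬p (g q)) q)

  𝟙-× : ∀ {P Q : Set} (p : Dec P) (q : Dec Q) → 𝟙 (p ×-dec q) ≡ 𝟙 p * 𝟙 q
  𝟙-× (yes _) (yes _) = refl
  𝟙-× (yes _) (no _)  = refl
  𝟙-× (no _)  _       = refl

  𝟙-partition : ∀ {P A B U : Set} (p : Dec P) (a : Dec A) (b : Dec B) (u : Dec U) →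
    (A → P) → (B → P) → (U → P) →
    (P → (A × ¬ B × ¬ U) ⊎ (¬ A × B × ¬ U) ⊎ (¬ A × ¬ B × U)) →
    𝟙 p ≡ 𝟙 a + 𝟙 b + 𝟙 u
  𝟙-partition (no ¬p) a b u A⇒P B⇒P U⇒P _
    rewrite 𝟙-no (λ x → ¬p (A⇒P x)) a | 𝟙-no (λ x → ¬p (B⇒P x)) b | 𝟙-no (λ x → ¬p (U⇒P x)) u = refl
  𝟙-partition (yes p) a b u _ _ _ classify with classify p
  ... | inj₁ (x , ¬y , ¬w)        rewrite 𝟙-yes x a | 𝟙-no ¬y b | 𝟙-no ¬w u = refl
  ... | inj₂ (inj₁ (¬x , y , ¬w)) rewrite 𝟙-no ¬x a | 𝟙-yes y b | 𝟙-no ¬w u = refl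
  ... | inj₂ (inj₂ (¬x , ¬y , w)) rewrite 𝟙-no ¬x a | 𝟙-no ¬y b | 𝟙-yes w u = refl

  𝟙-absorb : ∀ {A : Set} (a : Dec A) n → (A → n ≡ 1) → 𝟙 a ≡ 𝟙 a * n
  𝟙-absorb (yes x) n e = sym (cong (1 *_) (e x))
  𝟙-absorb (no _)  n e = refl

  sumL : ∀ {A : Set} → (A → ℕ) → List A → ℕ
  sumL f []       = 0
  sumL f (x ∷ xs) = f x + sumL f xs

  length-filter : ∀ {A : Set} {P : A → Set} (P? : Decidable P) (xs : List A) →
    length (filter P? xs) ≡ sumL (λ x → 𝟙 (P? x)) xs
  length-filter P? [] = refl
  length-filter P? (x ∷ xs) with P? x
  ... | yes _ = cong suc (length-filter P? xs)
  ... | no _  = length-filter P? xs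

  sumL-cong : ∀ {A : Set} {f g : A → ℕ} → (∀ x → f x ≡ g x) → ∀ xs → sumL f xs ≡ sumL g xs
  sumL-cong e []       = refl
  sumL-cong e (x ∷ xs) = cong₂ _+_ (e x) (sumL-cong e xs)

  sumL-zero : ∀ {A : Set} (f : A → ℕ) → (∀ x → f x ≡ 0) → ∀ xs → sumL f xs ≡ 0
  sumL-zero f e []       = refl
  sumL-zero f e (x ∷ xs) = cong₂ _+_ (e x) (sumL-zero f e xs)

  sumL-+ : ∀ {A : Set} (f g : A → ℕ) xs → sumL (λ x → f x + g x) xs ≡ sumL f xs + sumL g xs
  sumL-+ f g []       = refl
  sumL-+ f g (x ∷ xs) = trans (cong (λ t → f x + g x + t) (sumL-+ f g xs)) (interchange (f x) (g x) _ _)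

  sumL-*ˡ : ∀ {A : Set} a (f : A → ℕ) xs → sumL (λ x → a * f x) xs ≡ a * sumL f xs
  sumL-*ˡ a f []       = sym (ℕP.*-zeroʳ a)
  sumL-*ˡ a f (x ∷ xs) = trans (cong (λ t → a * f x + t) (sumL-*ˡ a f xs)) (sym (ℕP.*-distribˡ-+ a (f x) _))

  sumL-++ : ∀ {A : Set} (f : A → ℕ) xs ys → sumL f (xs ++ ys) ≡ sumL f xs + sumL f ys
  sumL-++ f []       ys = refl
  sumL-++ f (x ∷ xs) ys = trans (cong (λ t → f x + t) (sumL-++ f xs ys)) (sym (ℕP.+-assoc (f x) _ _))

  sumL-map : ∀ {A B : Set} (f : B → ℕ) (h : A → B) xs → sumL f (map h xs) ≡ sumL (λ x → f (h x)) xs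
  sumL-map f h []       = refl
  sumL-map f h (x ∷ xs) = cong (λ t → f (h x) + t) (sumL-map f h xs)

  sumL-concatMap : ∀ {A B : Set} (f : B → ℕ) (h : A → List B) xs →
    sumL f (concatMap h xs) ≡ sumL (λ x → sumL f (h x)) xs
  sumL-concatMap f h []       = refl
  sumL-concatMap f h (x ∷ xs) =
    trans (sumL-++ f (h x) (concatMap h xs)) (cong (λ t → sumL f (h x) + t) (sumL-concatMap f h xs))

  sumL-swap : ∀ {A B : Set} (h : A → B → ℕ) xs ys →
    sumL (λ x → sumL (h x) ys) xs ≡ sumL (λ y → sumL (λ x → h x y) xs) ys
  sumL-swap h []       ys = sym (sumL-zero _ (λ _ → refl) ys)
  sumL-swap h (x ∷ xs) ys =
    trans (cong (λ t → sumL (h x) ys + t) (sumL-swap h xs ys)) (sym (sumL-+ (h x) _ ys))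

  sumL-tabulate : ∀ {A : Set} {k} (f : A → ℕ) (g : Fin k → A) →
    sumL f (tabulate g) ≡ ∑[ i < k ] f (g i)
  sumL-tabulate {k = zero}  f g = refl
  sumL-tabulate {k = suc k} f g = cong (λ t → f (g fz) + t) (sumL-tabulate f (λ i → g (fs i)))

  ∑-const-1 : ∀ k → ∑[ i < k ] 1 ≡ k
  ∑-const-1 zero    = refl
  ∑-const-1 (suc k) = cong suc (∑-const-1 k)

  ∑-point : ∀ k (j : Fin k) → ∑[ i < k ] 𝟙 (i ≟F j) ≡ 1
  ∑-point (suc k) fz     = cong suc (trans (sum-cong-≗ {k} (λ i → 𝟙-no (λ ()) (fs i ≟F fz))) (sum-replicate-zero k))
  ∑-point (suc k) (fs j) = trans (sum-cong-≗ {k} (λ i → 𝟙-cong suc-injective (cong fs) (fs i ≟F fs j) (i ≟F j))) (∑-point k j)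

  -- Colourings of a vertex set Fin v are handled as ℕ-valued maps; a map into
  -- Fin k is seen through its ℕ-valued shadow ⟦ c ⟧, which is bounded by k.
  Colouring : ℕ → Set
  Colouring v = Fin v → ℕ

  _≐_ : ∀ {v} → Colouring v → Colouring v → Set
  c ≐ c′ = ∀ x → c x ≡ c′ x

  sym≐ : ∀ {v} {c c′ : Colouring v} → c ≐ c′ → c′ ≐ c
  sym≐ e x = sym (e x)

  trans≐ : ∀ {v} {c c′ c″ : Colouring v} → c ≐ c′ → c′ ≐ c″ → c ≐ c″
  trans≐ e e′ x = trans (e x) (e′ x)

  Bounded : ∀ {v} → ℕ → Colouring v → Set
  Bounded k c = ∀ x → c x < k

  ⟦_⟧ : ∀ {v k} → (Fin v → Fin k) → Colouring v
  ⟦ c ⟧ x = toℕ (c x)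

  ⟦⟧-bounded : ∀ {v k} (c : Fin v → Fin k) → Bounded k ⟦ c ⟧
  ⟦⟧-bounded c x = toℕ<n (c x)

  Represents : ∀ {v k} → (Fin v → Fin k) → Colouring v → Set
  Represents d e = ∀ x → toℕ (d x) ≡ e x

  represents? : ∀ {v k} (d : Fin v → Fin k) (e : Colouring v) → Dec (Represents d e)
  represents? d e = all? (λ x → toℕ (d x) ≟ e x)

  unique-representative : ∀ v k (e : Colouring v) → Bounded k e →
    sumL (λ d → 𝟙 (represents? d e)) (allFuns v k) ≡ 1
  unique-representative zero    k e _ = 𝟙-yes (λ ()) (represents? {k = k} (λ ()) e)
  unique-representative (suc v) k e e<k = begin
    sumL represented (concatMap (λ i → map (i ∷ᶠ_) (allFuns v k)) (allFin k))
      ≡⟨ sumL-concatMap represented _ (allFin k) ⟩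
    sumL (λ i → sumL represented (map (i ∷ᶠ_) (allFuns v k))) (allFin k)
      ≡⟨ sumL-cong (λ i → trans (sumL-map represented (i ∷ᶠ_) (allFuns v k)) (by-head i)) (allFin k) ⟩
    sumL (λ i → 𝟙 (i ≟F e₀)) (allFin k)
      ≡⟨ sumL-tabulate (λ i → 𝟙 (i ≟F e₀)) (λ i → i) ⟩
    ∑[ i < k ] 𝟙 (i ≟F e₀)
      ≡⟨ ∑-point k e₀ ⟩
    1 ∎
    where
    open ≡-Reasoning
    represented : (Fin (suc v) → Fin k) → ℕ
    represented d = 𝟙 (represents? d e)
    e₀ : Fin k
    e₀ = fromℕ< (e<k fz)
    tail-e : Colouring v
    tail-e x = e (fs x)
    head≡ : ∀ i → toℕ i ≡ e fz → i ≡ e₀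
    head≡ i p = toℕ-injective (trans p (sym (toℕ-fromℕ< (e<k fz))))
    split-represents : ∀ i d → 𝟙 (represents? (i ∷ᶠ d) e) ≡ 𝟙 (i ≟F e₀) * 𝟙 (represents? d tail-e)
    split-represents i d = trans
      (𝟙-cong (λ r → head≡ i (r fz) , (λ x → r (fs x)))
              (λ { (refl , r) → λ { fz → toℕ-fromℕ< (e<k fz) ; (fs x) → r x } })
              (represents? (i ∷ᶠ d) e) ((i ≟F e₀) ×-dec represents? d tail-e))
      (𝟙-× (i ≟F e₀) (represents? d tail-e))
    by-head : ∀ i → sumL (λ d → represented (i ∷ᶠ d)) (allFuns v k) ≡ 𝟙 (i ≟F e₀)
    by-head i = begin
      sumL (λ d → represented (i ∷ᶠ d)) (allFuns v k)
        ≡⟨ sumL-cong (split-represents i) (allFuns v k) ⟩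
      sumL (λ d → 𝟙 (i ≟F e₀) * 𝟙 (represents? d tail-e)) (allFuns v k)
        ≡⟨ sumL-*ˡ (𝟙 (i ≟F e₀)) _ (allFuns v k) ⟩
      𝟙 (i ≟F e₀) * sumL (λ d → 𝟙 (represents? d tail-e)) (allFuns v k)
        ≡⟨ cong (𝟙 (i ≟F e₀) *_) (unique-representative v k tail-e (λ x → e<k (fs x))) ⟩
      𝟙 (i ≟F e₀) * 1
        ≡⟨ ℕP.*-identityʳ _ ⟩
      𝟙 (i ≟F e₀) ∎

  count : ∀ {v} k {P : Colouring v → Set} → Decidable P → ℕ
  count {v} k P? = sumL (λ c → 𝟙 (P? ⟦ c ⟧)) (allFuns v k)

  count-cong : ∀ {v} k {P Q : Colouring v → Set} (P? : Decidable P) (Q? : Decidable Q) →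
    (∀ c → Bounded k c → P c → Q c) → (∀ c → Bounded k c → Q c → P c) → count k P? ≡ count k Q?
  count-cong {v} k P? Q? P⇒Q Q⇒P =
    sumL-cong (λ c → 𝟙-cong (P⇒Q _ (⟦⟧-bounded c)) (Q⇒P _ (⟦⟧-bounded c)) (P? ⟦ c ⟧) (Q? ⟦ c ⟧)) (allFuns v k)

  count-zero : ∀ {v} k {P : Colouring v → Set} (P? : Decidable P) → (∀ c → Bounded k c → ¬ P c) → count k P? ≡ 0
  count-zero {v} k P? none = sumL-zero _ (λ c → 𝟙-no (none _ (⟦⟧-bounded c)) (P? ⟦ c ⟧)) (allFuns v k)

  record Correspondence {v} (k₁ k₂ : ℕ) (P Q : Colouring v → Set) : Set where
    field
      to from   : Colouring v → Colouring v
      to-cong   : ∀ {c c′} → c ≐ c′ → to c ≐ to c′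
      from-cong : ∀ {c c′} → c ≐ c′ → from c ≐ from c′
      P-resp    : ∀ {c c′} → c ≐ c′ → P c → P c′
      Q-resp    : ∀ {c c′} → c ≐ c′ → Q c → Q c′
      to-maps   : ∀ c → Bounded k₁ c → P c → Bounded k₂ (to c) × Q (to c)
      from-maps : ∀ c → Bounded k₂ c → Q c → Bounded k₁ (from c) × P (from c)
      from∘to   : ∀ c → Bounded k₁ c → P c → from (to c) ≐ c
      to∘from   : ∀ c → Bounded k₂ c → Q c → to (from c) ≐ c

  -- Bijection principle: corresponding sets of colourings have the same size.
  -- Proof by double counting the pairs (c , d) with d = to c, i.e. c = from d.
  count-correspondence : ∀ {v k₁ k₂} {P Q : Colouring v → Set} (P? : Decidable P) (Q? : Decidable Q) →
    Correspondence k₁ k₂ P Q → count k₁ P? ≡ count k₂ Q?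
  count-correspondence {v} {k₁} {k₂} {P} {Q} P? Q? corr = begin
    sumL (λ c → 𝟙 (P? ⟦ c ⟧)) L₁
      ≡⟨ sumL-cong (λ c → pairs-of-P c) L₁ ⟩
    sumL (λ c → sumL (λ d → pair c d) L₂) L₁
      ≡⟨ sumL-cong (λ c → sumL-cong (pair-symmetric c) L₂) L₁ ⟩
    sumL (λ c → sumL (λ d → pair′ c d) L₂) L₁
      ≡⟨ sumL-swap pair′ L₁ L₂ ⟩
    sumL (λ d → sumL (λ c → pair′ c d) L₁) L₂
      ≡⟨ sumL-cong (λ d → sym (pairs-of-Q d)) L₂ ⟩
    sumL (λ d → 𝟙 (Q? ⟦ d ⟧)) L₂ ∎
    where
    open ≡-Reasoning
    open Correspondence corr
    L₁ = allFuns v k₁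
    L₂ = allFuns v k₂
    pair : (Fin v → Fin k₁) → (Fin v → Fin k₂) → ℕ
    pair c d = 𝟙 (P? ⟦ c ⟧) * 𝟙 (represents? d (to ⟦ c ⟧))
    pair′ : (Fin v → Fin k₁) → (Fin v → Fin k₂) → ℕ
    pair′ c d = 𝟙 (Q? ⟦ d ⟧) * 𝟙 (represents? c (from ⟦ d ⟧))
    pairs-of-P : ∀ c → 𝟙 (P? ⟦ c ⟧) ≡ sumL (λ d → pair c d) L₂
    pairs-of-P c = trans
      (𝟙-absorb (P? ⟦ c ⟧) _ (λ p → unique-representative v k₂ _ (proj₁ (to-maps _ (⟦⟧-bounded c) p))))
      (sym (sumL-*ˡ (𝟙 (P? ⟦ c ⟧)) _ L₂))
    pairs-of-Q : ∀ d → 𝟙 (Q? ⟦ d ⟧) ≡ sumL (λ c → pair′ c d) L₁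
    pairs-of-Q d = trans
      (𝟙-absorb (Q? ⟦ d ⟧) _ (λ q → unique-representative v k₁ _ (proj₁ (from-maps _ (⟦⟧-bounded d) q))))
      (sym (sumL-*ˡ (𝟙 (Q? ⟦ d ⟧)) _ L₁))
    pair-symmetric : ∀ c d → pair c d ≡ pair′ c d
    pair-symmetric c d = begin
      𝟙 (P? ⟦ c ⟧) * 𝟙 (represents? d (to ⟦ c ⟧))
        ≡⟨ sym (𝟙-× (P? ⟦ c ⟧) (represents? d (to ⟦ c ⟧))) ⟩
      𝟙 (P? ⟦ c ⟧ ×-dec represents? d (to ⟦ c ⟧))
        ≡⟨ 𝟙-cong forth back _ _ ⟩
      𝟙 (Q? ⟦ d ⟧ ×-dec represents? c (from ⟦ d ⟧))
        ≡⟨ 𝟙-× (Q? ⟦ d ⟧) (represents? c (from ⟦ d ⟧)) ⟩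
      𝟙 (Q? ⟦ d ⟧) * 𝟙 (represents? c (from ⟦ d ⟧)) ∎
      where
      forth : P ⟦ c ⟧ × Represents d (to ⟦ c ⟧) → Q ⟦ d ⟧ × Represents c (from ⟦ d ⟧)
      forth (p , r) = Q-resp (sym≐ r) (proj₂ (to-maps _ (⟦⟧-bounded c) p))
                    , trans≐ (sym≐ (from∘to _ (⟦⟧-bounded c) p)) (from-cong (sym≐ r))
      back : Q ⟦ d ⟧ × Represents c (from ⟦ d ⟧) → P ⟦ c ⟧ × Represents d (to ⟦ c ⟧)
      back (q , r) = P-resp (sym≐ r) (proj₂ (from-maps _ (⟦⟧-bounded d) q))
                   , trans≐ (sym≐ (to∘from _ (⟦⟧-bounded d) q)) (to-cong (sym≐ r))

  count-singleton : ∀ {v} k (e : Colouring v) → Bounded k e → count k (λ c → all? (λ x → c x ≟ e x)) ≡ 1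
  count-singleton {v} k e e<k = unique-representative v k e e<k

module AlternatingSums where

  open import Data.Nat using (zero; suc)
  import Data.Nat as ℕ
  open import Data.Integer using (ℤ; _+_; _*_; _-_; -_)
  import Data.Integer.Properties as ℤP
  open import Data.Integer.Solver using (module +-*-Solver)
  open import Data.List using (map; applyUpTo)
  open import Relation.Binary.PropositionalEquality
  open +-*-Solver using (solve; _:+_; _:-_; _:*_; :-_; _:=_)

  -- The alternating sum  alt g n = Σ_{r<n} (-1)^r g r.
  alt : (ℕ → ℤ) → ℕ → ℤ
  alt g zero    = + 0
  alt g (suc n) = g 0 - alt (λ r → g (suc r)) n

  alt-cong : ∀ {g h : ℕ → ℤ} n → (∀ r → g r ≡ h r) → alt g n ≡ alt h n
  alt-cong zero    e = refl
  alt-cong (suc n) e = cong₂ _-_ (e 0) (alt-cong n (λ r → e (suc r)))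

  alt-+ : ∀ (f g : ℕ → ℤ) n → alt (λ r → f r + g r) n ≡ alt f n + alt g n
  alt-+ f g zero    = refl
  alt-+ f g (suc n) =
    trans (cong (λ t → f 0 + g 0 - t) (alt-+ (λ r → f (suc r)) (λ r → g (suc r)) n))
          (solve 4 (λ a b c d → (a :+ b) :- (c :+ d) := (a :- c) :+ (b :- d)) refl (f 0) (g 0) _ _)

  alt-zero : ∀ (g : ℕ → ℤ) n → (∀ r → g r ≡ + 0) → alt g n ≡ + 0
  alt-zero g zero    e = refl
  alt-zero g (suc n) e = cong₂ _-_ (e 0) (alt-zero (λ r → g (suc r)) n (λ r → e (suc r)))

  alt-drop-last : ∀ (g : ℕ → ℤ) n → g n ≡ + 0 → alt g (suc n) ≡ alt g n
  alt-drop-last g zero    e = cong (_- + 0) e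
  alt-drop-last g (suc n) e = cong (λ t → g 0 - t) (alt-drop-last (λ r → g (suc r)) n e)

  alt-telescope : ∀ (b : ℕ → ℤ) n → b n ≡ + 0 → alt (λ r → b r + b (suc r)) n ≡ b 0
  alt-telescope b zero    e = sym e
  alt-telescope b (suc n) e =
    trans (cong (λ t → b 0 + b 1 - t) (alt-telescope (λ r → b (suc r)) n e))
          (solve 2 (λ a c → (a :+ c) :- c := a) refl (b 0) (b 1))

  sum-signed≡alt : ∀ (g : ℕ → ℤ) n → sumℤ (map (λ r → g r * -1ℤ ^ r) (applyUpTo (λ r → r) n)) ≡ alt g n
  sum-signed≡alt g n = trans (sumℤ-applyUpTo (λ r → g r * -1ℤ ^ r) n) (signs g n)
    where
    sumN : (ℕ → ℤ) → ℕ → ℤ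
    sumN h zero    = + 0
    sumN h (suc n) = h 0 + sumN (λ r → h (suc r)) n
    sumℤ-applyUpTo : ∀ {f : ℕ → ℕ} (h : ℕ → ℤ) n → sumℤ (map h (applyUpTo f n)) ≡ sumN (λ r → h (f r)) n
    sumℤ-applyUpTo h zero    = refl
    sumℤ-applyUpTo h (suc n) = cong (λ t → h _ + t) (sumℤ-applyUpTo h n)
    sumN-neg : ∀ (h : ℕ → ℤ) n → sumN (λ r → - h r) n ≡ - sumN h n
    sumN-neg h zero    = refl
    sumN-neg h (suc n) = trans (cong (λ t → - h 0 + t) (sumN-neg (λ r → h (suc r)) n))
                               (sym (ℤP.neg-distrib-+ (h 0) _))
    signs : ∀ (g : ℕ → ℤ) n → sumN (λ r → g r * -1ℤ ^ r) n ≡ alt g n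
    signs g zero    = refl
    signs g (suc n) = cong₂ _+_ (ℤP.*-identityʳ (g 0)) (begin
      sumN (λ r → g (suc r) * (-1ℤ * -1ℤ ^ r)) n
        ≡⟨ sumN-cong n (λ r → solve 2 (λ a s → a :* (con -1ℤ :* s) := :- (a :* s)) refl (g (suc r)) (-1ℤ ^ r)) ⟩
      sumN (λ r → - (g (suc r) * -1ℤ ^ r)) n
        ≡⟨ sumN-neg (λ r → g (suc r) * -1ℤ ^ r) n ⟩
      - sumN (λ r → g (suc r) * -1ℤ ^ r) n
        ≡⟨ cong -_ (signs (λ r → g (suc r)) n) ⟩
      - alt (λ r → g (suc r)) n ∎)
      where
      open ≡-Reasoning
      open +-*-Solver using (con)
      sumN-cong : ∀ {h h′ : ℕ → ℤ} n → (∀ r → h r ≡ h′ r) → sumN h n ≡ sumN h′ n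
      sumN-cong zero    e = refl
      sumN-cong (suc n) e = cong₂ _+_ (e 0) (sumN-cong n (λ r → e (suc r)))

  -- If the terms split as  e r = a r + b r + u r  where
  -- a r is matched with b (r+1), and there is nothing to match at the ends
  -- (b 0 = 0, a v = 0), then only the unmatched terms u contribute.
  alt-cancel : ∀ (e a b u : ℕ → ℕ) v → (∀ r → e r ≡ a r ℕ.+ b r ℕ.+ u r) →
    (∀ r → a r ≡ b (suc r)) → b 0 ≡ 0 → a v ≡ 0 →
    alt (λ r → + e r) (suc v) ≡ alt (λ r → + u r) (suc v)
  alt-cancel e a b u v split match b₀ aᵥ = begin
    alt (λ r → + e r) (suc v)
      ≡⟨ alt-cong (suc v) regroup ⟩
    alt (λ r → (+ b r + + b (suc r)) + + u r) (suc v)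
      ≡⟨ alt-+ (λ r → + b r + + b (suc r)) (λ r → + u r) (suc v) ⟩
    alt (λ r → + b r + + b (suc r)) (suc v) + alt (λ r → + u r) (suc v)
      ≡⟨ cong (_+ alt (λ r → + u r) (suc v)) (alt-telescope (λ r → + b r) (suc v) (cong +_ (trans (sym (match v)) aᵥ))) ⟩
    + b 0 + alt (λ r → + u r) (suc v)
      ≡⟨ trans (cong (λ t → + t + alt (λ r → + u r) (suc v)) b₀) (ℤP.+-identityˡ _) ⟩
    alt (λ r → + u r) (suc v) ∎
    where
    open ≡-Reasoning
    regroup : ∀ r → + e r ≡ (+ b r + + b (suc r)) + + u r
    regroup r = begin
      + e r                                 ≡⟨ cong +_ (trans (split r) (cong (λ t → t ℕ.+ b r ℕ.+ u r) (match r))) ⟩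
      + (b (suc r) ℕ.+ b r ℕ.+ u r)         ≡⟨ trans (ℤP.pos-+ _ (u r)) (cong (_+ + u r) (ℤP.pos-+ (b (suc r)) (b r))) ⟩
      (+ b (suc r) + + b r) + + u r         ≡⟨ cong (_+ + u r) (ℤP.+-comm (+ b (suc r)) (+ b r)) ⟩
      (+ b r + + b (suc r)) + + u r ∎

module Recolouring where

  open import Data.Nat using (suc; pred; _≤_; z≤n; s≤s; s<s; s<s⁻¹; s≤s⁻¹)
  open import Data.Nat.Properties
  open import Data.Sum using (_⊎_; inj₁; inj₂)
  open import Relation.Binary.PropositionalEquality
  open import Relation.Nullary using (yes; no; contradiction)

  suc-pred-pos : ∀ {n} → 0 < n → suc (pred n) ≡ n
  suc-pred-pos {suc _} _ = refl

  pred-strict : ∀ {a b} → 0 < a → a < b → pred a < pred b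
  pred-strict {suc _} {suc _} _ a<b = s<s⁻¹ a<b

  -- bump i : insert a new colour just above i (colours > i move up by one).
  bump : ℕ → ℕ → ℕ
  bump i m with m ≤? i
  ... | yes _ = m
  ... | no  _ = suc m

  -- unbump I : remove the colour I (colours > I move down by one).
  unbump : ℕ → ℕ → ℕ
  unbump I m with m ≤? I
  ... | yes _ = m
  ... | no  _ = pred m

  bump-cases : ∀ i m → (m ≤ i × bump i m ≡ m) ⊎ (i < m × bump i m ≡ suc m)
  bump-cases i m with m ≤? i
  ... | yes m≤i = inj₁ (m≤i , refl)
  ... | no  m≰i = inj₂ (≰⇒> m≰i , refl)

  unbump-cases : ∀ I m → (m ≤ I × unbump I m ≡ m) ⊎ (I < m × unbump I m ≡ pred m)
  unbump-cases I m with m ≤? I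
  ... | yes m≤I = inj₁ (m≤I , refl)
  ... | no  m≰I = inj₂ (≰⇒> m≰I , refl)

  bump-low : ∀ {i m} → m ≤ i → bump i m ≡ m
  bump-low {i} {m} m≤i with bump-cases i m
  ... | inj₁ (_ , e)   = e
  ... | inj₂ (i<m , _) = contradiction m≤i (<⇒≱ i<m)

  bump-high : ∀ {i m} → i < m → bump i m ≡ suc m
  bump-high {i} {m} i<m with bump-cases i m
  ... | inj₁ (m≤i , _) = contradiction m≤i (<⇒≱ i<m)
  ... | inj₂ (_ , e)   = e

  unbump-low : ∀ {I m} → m ≤ I → unbump I m ≡ m
  unbump-low {I} {m} m≤I with unbump-cases I m
  ... | inj₁ (_ , e)   = e
  ... | inj₂ (I<m , _) = contradiction m≤I (<⇒≱ I<m)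

  unbump-high : ∀ {I m} → I < m → unbump I m ≡ pred m
  unbump-high {I} {m} I<m with unbump-cases I m
  ... | inj₁ (m≤I , _) = contradiction m≤I (<⇒≱ I<m)
  ... | inj₂ (_ , e)   = e

  bump-inflationary : ∀ i m → m ≤ bump i m
  bump-inflationary i m with bump-cases i m
  ... | inj₁ (_ , e) = ≤-reflexive (sym e)
  ... | inj₂ (_ , e) = subst (m ≤_) (sym e) (n≤1+n m)

  bump-≤-suc : ∀ i m → bump i m ≤ suc m
  bump-≤-suc i m with bump-cases i m
  ... | inj₁ (_ , e) = subst (_≤ suc m) (sym e) (n≤1+n m)
  ... | inj₂ (_ , e) = ≤-reflexive e

  bump-mono : ∀ i {a b} → a < b → bump i a < bump i b
  bump-mono i {a} {b} a<b with bump-cases i a | bump-cases i b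
  ... | inj₁ (_ , ea)   | inj₁ (_ , eb)   = subst₂ _<_ (sym ea) (sym eb) a<b
  ... | inj₁ (_ , ea)   | inj₂ (_ , eb)   = subst₂ _<_ (sym ea) (sym eb) (m<n⇒m<1+n a<b)
  ... | inj₂ (i<a , _)  | inj₁ (b≤i , _)  = contradiction (<-trans i<a a<b) (≤⇒≯ b≤i)
  ... | inj₂ (_ , ea)   | inj₂ (_ , eb)   = subst₂ _<_ (sym ea) (sym eb) (s<s a<b)

  unbump-mono : ∀ I {a b} → a < b → a ≢ I → b ≢ I → unbump I a < unbump I b
  unbump-mono I {a} {b} a<b a≢I b≢I with unbump-cases I a | unbump-cases I b
  ... | inj₁ (_ , ea)   | inj₁ (_ , eb)   = subst₂ _<_ (sym ea) (sym eb) a<b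
  ... | inj₁ (a≤I , ea) | inj₂ (I<b , eb) = subst₂ _<_ (sym ea) (sym eb) (<-≤-trans (≤∧≢⇒< a≤I a≢I) (pred-mono-≤ I<b))
  ... | inj₂ (I<a , _)  | inj₁ (b≤I , _)  = contradiction (<-trans I<a a<b) (≤⇒≯ b≤I)
  ... | inj₂ (I<a , ea) | inj₂ (_ , eb)   = subst₂ _<_ (sym ea) (sym eb) (pred-strict (≤-<-trans z≤n I<a) a<b)

  unbump-bounded : ∀ {I m k} → m ≢ I → I ≤ k → m < suc k → unbump I m < k
  unbump-bounded {I} {m} m≢I I≤k m<1+k with unbump-cases I m
  ... | inj₁ (m≤I , e) = subst (_< _) (sym e) (<-≤-trans (≤∧≢⇒< m≤I m≢I) I≤k)
  ... | inj₂ (I<m , e) = subst (_< _) (sym e) (pred-below I<m m<1+k)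
    where
    pred-below : ∀ {I m k} → I < m → m < suc k → pred m < k
    pred-below {m = suc _} _ m<1+k = s<s⁻¹ m<1+k

  unbump-positive : ∀ {I m} → 0 < I → 0 < m → 0 < unbump I m
  unbump-positive {I} {m} 0<I 0<m with unbump-cases I m
  ... | inj₁ (_ , e)   = subst (0 <_) (sym e) 0<m
  ... | inj₂ (I<m , e) = subst (0 <_) (sym e) (<-≤-trans 0<I (pred-mono-≤ I<m))

  bump-fresh : ∀ i m → bump i m ≢ suc i
  bump-fresh i m with bump-cases i m
  ... | inj₁ (m≤i , e) = λ e′ → <-irrefl (trans (sym e) e′) (s≤s m≤i)
  ... | inj₂ (i<m , e) = λ e′ → <-irrefl (suc-injective (trans (sym e′) e)) i<m

  unbump-bump : ∀ i m → unbump (suc i) (bump i m) ≡ m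
  unbump-bump i m with bump-cases i m
  ... | inj₁ (m≤i , e) = trans (cong (unbump (suc i)) e) (unbump-low (m≤n⇒m≤1+n m≤i))
  ... | inj₂ (i<m , e) = trans (cong (unbump (suc i)) e) (unbump-high (s<s i<m))

  bump-unbump : ∀ i m → m ≢ suc i → bump i (unbump (suc i) m) ≡ m
  bump-unbump i m m≢ with unbump-cases (suc i) m
  ... | inj₁ (m≤1+i , e) = trans (cong (bump i) e) (bump-low (s≤s⁻¹ (≤∧≢⇒< m≤1+i m≢)))
  ... | inj₂ (1+i<m , e) = trans (cong (bump i) e) (lift 1+i<m)
    where
    lift : ∀ {m} → suc i < m → bump i (pred m) ≡ m
    lift {suc m} 1+i<m = bump-high (s<s⁻¹ 1+i<m)

  bump-one : ∀ {i m} → bump i m ≡ 1 → m ≡ 1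
  bump-one {i} {m} e with bump-cases i m
  ... | inj₁ (_ , b≡m)     = trans (sym b≡m) e
  ... | inj₂ (i<m , b≡1+m) = contradiction (subst (i <_) (suc-injective (trans (sym b≡1+m) e)) i<m) n≮0

module ForestColourings {v : ℕ} (parent : Fin v → Maybe (Fin v))
                        (acyclic : ∀ x → anc parent v x ≡ nothing) where
  open import Data.Nat using (zero; suc; pred; _+_; _≤_; _≟_; z≤n; s≤s; z<s; s<s; s≤s⁻¹)
  open import Data.Nat.Properties hiding (_≟_)
  open import Data.Fin using (toℕ)
  open import Data.Fin.Properties using (all?; any?; toℕ<n; pigeonhole; ¬∀⟶∃¬) renaming (_≟_ to _≟F_)
  open import Data.Maybe using (_>>=_)
  open import Data.Maybe.Properties using (≡-dec)
  open import Data.Product using (∃; ∃-syntax; proj₁; proj₂)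
  open import Data.Sum using (_⊎_; inj₁; inj₂)
  open import Data.Unit using (⊤; tt)
  open import Relation.Binary.PropositionalEquality
  open import Relation.Binary.Definitions using (tri<; tri≈; tri>)
  open import Relation.Nullary using (yes; no; contradiction)
  open import Relation.Nullary.Decidable using (_×-dec_; _⊎-dec_; _→-dec_; ¬?; map′)
  open import Relation.Unary using (Decidable)
  open import Data.Integer using (ℤ; _-_; -_)
  import Data.Integer.Properties as ℤP
  open import Algebra.Properties.CommutativeMonoid.Sum +-0-commutativeMonoid
    using (sum-syntax; sum-cong-≗; sum-replicate-zero; ∑-distrib-+)
  open Counting
  open AlternatingSums
  open Recolouring

  Minimal : (Fin v → Set) → Fin v → Set
  Minimal Z z = ¬ Z z × (∀ y → parent y ≡ just z → Z y)

  anc-suc : ∀ n x → anc parent (suc n) x ≡ (parent x >>= anc parent n)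
  anc-suc zero x with parent x
  ... | just _  = refl
  ... | nothing = refl
  anc-suc (suc n) x rewrite anc-suc n x with parent x
  ... | just _  = refl
  ... | nothing = refl

  -- Every vertex outside Z lies above a Z-minimal vertex: otherwise one could
  -- descend from it through v + 1 vertices outside Z, contradicting acyclicity.
  minimal-exists : ∀ {Z} → Decidable Z → ∀ x₀ → ¬ Z x₀ → ∃ (Minimal Z)
  minimal-exists {Z} Z? x₀ x₀∉Z with any? (λ z → ¬? (Z? z) ×-dec all? (λ y → ≡-dec _≟F_ (parent y) (just z) →-dec Z? y))
  ... | yes found = found
  ... | no none   = contradiction (trans (sym (proj₂ (proj₂ (descend v)))) (acyclic _)) λ ()
    where
    child-outside : ∀ x → ¬ Z x → ∃[ y ] (parent y ≡ just x × ¬ Z y)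
    child-outside x x∉Z with ¬∀⟶∃¬ v _ (λ y → ≡-dec _≟F_ (parent y) (just x) →-dec Z? y) (λ all → none (x , x∉Z , all))
    ... | y , ¬[py⇒Zy] with Z? y
    ... | yes y∈Z = contradiction (λ _ → y∈Z) ¬[py⇒Zy]
    ... | no  y∉Z with ≡-dec _≟F_ (parent y) (just x)
    ...   | yes py = y , py , y∉Z
    ...   | no ¬py = contradiction (λ py → contradiction py ¬py) ¬[py⇒Zy]
    descend : ∀ n → ∃[ y ] (¬ Z y × anc parent n y ≡ just x₀)
    descend zero = x₀ , x₀∉Z , refl
    descend (suc n) with descend n
    ... | y , y∉Z , up with child-outside y y∉Z
    ... | y′ , py′ , y′∉Z = y′ , y′∉Z , trans (anc-suc n y′) (trans (cong (_>>= anc parent n) py′) up)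

  -- Colourings relative to a "zero set" Z of vertices (for a forest: its leaves).
  module ZeroSet (Z : Fin v → Set) (Z? : Decidable Z) where

    record Admissible (r : ℕ) (c : Colouring v) : Set where
      field
        onto       : ∀ j → j ≤ r → ∃[ x ] c x ≡ j
        zero-on    : ∀ x → Z x → c x ≡ 0
        positive   : ∀ x → ¬ Z x → 0 < c x
        descending : ∀ x y → parent y ≡ just x → ¬ Z x → ¬ Z y → c y < c x

    admissible? : ∀ r → Decidable (Admissible r)
    admissible? r c = map′
      (λ (o , zo , p , d) → record { onto = λ j j≤r → o (s≤s j≤r) ; zero-on = zo ; positive = p ; descending = d })
      (λ a → let open Admissible a in (λ {j} j<1+r → onto j (s≤s⁻¹ j<1+r)) , zero-on , positive , descending)
      (allUpTo? (λ j → any? (λ x → c x ≟ j)) (suc r)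
        ×-dec all? (λ x → Z? x →-dec (c x ≟ 0))
        ×-dec all? (λ x → ¬? (Z? x) →-dec (0 <? c x))
        ×-dec all? (λ x → all? (λ y → ≡-dec _≟F_ (parent y) (just x) →-dec (¬? (Z? x) →-dec (¬? (Z? y) →-dec (c y <? c x))))))

    admissible-resp : ∀ r {c c′} → c ≐ c′ → Admissible r c → Admissible r c′
    admissible-resp r {c} {c′} c≐c′ a = record
      { onto       = λ j j≤r → let (x , e) = onto j j≤r in x , trans (sym (c≐c′ x)) e
      ; zero-on    = λ x x∈Z → trans (sym (c≐c′ x)) (zero-on x x∈Z)
      ; positive   = λ x x∉Z → subst (0 <_) (c≐c′ x) (positive x x∉Z)
      ; descending = λ x y py x∉Z y∉Z → subst₂ _<_ (c≐c′ y) (c≐c′ x) (descending x y py x∉Z y∉Z) }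
      where open Admissible a

    length-bound : ∀ {r c} → Admissible r c → r < v
    length-bound {r} {c} a with v ≤? r
    ... | no  v≰r = ≰⇒> v≰r
    ... | yes v≤r = let (i , j , i<j , same) = pigeonhole (s≤s v≤r) (λ j → proj₁ (hit j)) in
      contradiction (trans (sym (proj₂ (hit i))) (trans (cong c same) (proj₂ (hit j)))) (<⇒≢ i<j)
      where
      hit : (j : Fin (suc r)) → ∃[ x ] c x ≡ toℕ j
      hit j = Admissible.onto a (toℕ j) (s≤s⁻¹ (toℕ<n j))

    signedCount : ℤ
    signedCount = alt (λ r → + count (suc r) (admissible? r)) (suc v)

    outside : ℕ
    outside = ∑[ x < v ] 𝟙 (¬? (Z? x))

    -- The
    -- W-admissible colourings are cancelled in pairs by splitting off z into a
    -- colour class of its own, except those where z alone has colour 1.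
    module Involution (z : Fin v) (z-minimal : Minimal Z z)
                      (W : Colouring v → Set) (W? : Decidable W)
                      (W-resp : ∀ {c c′} → c ≐ c′ → W c → W c′) where

      z∉Z : ¬ Z z
      z∉Z = proj₁ z-minimal

      Shared : Colouring v → Set
      Shared c = ∃[ x ] (x ≢ z × c x ≡ c z)

      Alone : Colouring v → Set
      Alone c = ∀ x → x ≢ z → c x ≢ c z

      unshared⇒alone : ∀ {c} → ¬ Shared c → Alone c
      unshared⇒alone ¬sh x x≢z same = ¬sh (x , x≢z , same)

      Good ZShares ZAloneHigh ZAloneAtOne : ℕ → Colouring v → Set
      Good        r c = Admissible r c × W c
      ZShares     r c = Good r c × Shared c
      ZAloneHigh  r c = Good r c × Alone c × 2 ≤ c z
      ZAloneAtOne r c = Good r c × Alone c × c z ≡ 1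

      alone? : Decidable Alone
      alone? c = all? (λ x → ¬? (x ≟F z) →-dec ¬? (c x ≟ c z))

      good? : ∀ r → Decidable (Good r)
      good? r c = admissible? r c ×-dec W? c

      zShares? : ∀ r → Decidable (ZShares r)
      zShares? r c = good? r c ×-dec any? (λ x → ¬? (x ≟F z) ×-dec (c x ≟ c z))

      zAloneHigh? : ∀ r → Decidable (ZAloneHigh r)
      zAloneHigh? r c = good? r c ×-dec (alone? c ×-dec (2 ≤? c z))

      zAloneAtOne? : ∀ r → Decidable (ZAloneAtOne r)
      zAloneAtOne? r c = good? r c ×-dec (alone? c ×-dec (c z ≟ 1))

      split : Colouring v → Colouring v
      split c x with x ≟F z
      ... | yes _ = suc (c z)
      ... | no  _ = bump (c z) (c x)

      merge : Colouring v → Colouring v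
      merge c x with x ≟F z
      ... | yes _ = pred (c z)
      ... | no  _ = unbump (c z) (c x)

      split-at-z : ∀ c → split c z ≡ suc (c z)
      split-at-z c with z ≟F z
      ... | yes _   = refl
      ... | no  z≢z = contradiction refl z≢z

      split-off-z : ∀ c {x} → x ≢ z → split c x ≡ bump (c z) (c x)
      split-off-z c {x} x≢z with x ≟F z
      ... | yes x≡z = contradiction x≡z x≢z
      ... | no  _   = refl

      merge-at-z : ∀ c → merge c z ≡ pred (c z)
      merge-at-z c with z ≟F z
      ... | yes _   = refl
      ... | no  z≢z = contradiction refl z≢z

      merge-off-z : ∀ c {x} → x ≢ z → merge c x ≡ unbump (c z) (c x)
      merge-off-z c {x} x≢z with x ≟F z
      ... | yes x≡z = contradiction x≡z x≢z
      ... | no  _   = refl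

      split-cong : ∀ {c c′} → c ≐ c′ → split c ≐ split c′
      split-cong {c} {c′} e x with x ≟F z
      ... | yes _ = cong suc (e z)
      ... | no  _ = cong₂ bump (e z) (e x)

      merge-cong : ∀ {c c′} → c ≐ c′ → merge c ≐ merge c′
      merge-cong {c} {c′} e x with x ≟F z
      ... | yes _ = cong pred (e z)
      ... | no  _ = cong₂ unbump (e z) (e x)

      other : ∀ {c : Colouring v} {x} → c x ≢ c z → x ≢ z
      other c≢ refl = c≢ refl

      in-Z-other : ∀ {x} → Z x → x ≢ z
      in-Z-other x∈Z refl = z∉Z x∈Z

      at-or-off-z : ∀ x → x ≡ z ⊎ x ≢ z
      at-or-off-z x with x ≟F z
      ... | yes x≡z = inj₁ x≡z
      ... | no  x≢z = inj₂ x≢z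

      merge-split : ∀ c → merge (split c) ≐ c
      merge-split c x with at-or-off-z x
      ... | inj₁ refl = trans (merge-at-z (split c)) (cong pred (split-at-z c))
      ... | inj₂ x≢z  = begin
        merge (split c) x                  ≡⟨ merge-off-z (split c) x≢z ⟩
        unbump (split c z) (split c x)     ≡⟨ cong₂ unbump (split-at-z c) (split-off-z c x≢z) ⟩
        unbump (suc (c z)) (bump (c z) (c x)) ≡⟨ unbump-bump (c z) (c x) ⟩
        c x                                ∎
        where open ≡-Reasoning

      split-merge : ∀ c → Alone c → 0 < c z → split (merge c) ≐ c
      split-merge c alone 0<cz x with at-or-off-z x
      ... | inj₁ refl = trans (split-at-z (merge c)) (trans (cong suc (merge-at-z c)) (suc-pred-pos 0<cz))
      ... | inj₂ x≢z  = begin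
        split (merge c) x                          ≡⟨ split-off-z (merge c) x≢z ⟩
        bump (merge c z) (merge c x)               ≡⟨ cong₂ bump (merge-at-z c) (merge-off-z c x≢z) ⟩
        bump (pred (c z)) (unbump (c z) (c x))     ≡⟨ cong (λ I → bump (pred (c z)) (unbump I (c x))) (sym (suc-pred-pos 0<cz)) ⟩
        bump (pred (c z)) (unbump (suc (pred (c z))) (c x))
          ≡⟨ bump-unbump (pred (c z)) (c x) (λ e → alone x x≢z (trans e (suc-pred-pos 0<cz))) ⟩
        c x                                        ∎
        where open ≡-Reasoning

      module SplitFacts {r c} (c<1+r : Bounded (suc r) c) (adm : Admissible r c) (shared : Shared c) where
        open Admissible adm

        i : ℕ
        i = c z

        0<i : 0 < i
        0<i = positive z z∉Z

        keep : ∀ {x} → x ≢ z → c x ≤ i → split c x ≡ c x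
        keep x≢z le = trans (split-off-z c x≢z) (bump-low le)

        lift : ∀ {x} → x ≢ z → i < c x → split c x ≡ suc (c x)
        lift x≢z lt = trans (split-off-z c x≢z) (bump-high lt)

        bounded′ : Bounded (suc (suc r)) (split c)
        bounded′ x with at-or-off-z x
        ... | inj₁ refl = subst (_< suc (suc r)) (sym (split-at-z c)) (s<s (c<1+r z))
        ... | inj₂ x≢z  = subst (_< suc (suc r)) (sym (split-off-z c x≢z))
                                (≤-<-trans (bump-≤-suc i (c x)) (s<s (c<1+r x)))

        onto′ : ∀ j → j ≤ suc r → ∃[ x ] split c x ≡ j
        onto′ j j≤1+r with <-cmp j i
        ... | tri< j<i _ _ = let (x , cx≡j) = onto j (≤-trans (<⇒≤ j<i) (s≤s⁻¹ (c<1+r z))) in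
          x , trans (keep (other {c} (λ e → <⇒≢ j<i (trans (sym cx≡j) e))) (subst (_≤ i) (sym cx≡j) (<⇒≤ j<i))) cx≡j
        ... | tri≈ _ j≡i _ = let (x , x≢z , cx≡i) = shared in
          x , trans (keep x≢z (≤-reflexive cx≡i)) (trans cx≡i (sym j≡i))
        onto′ zero    _     | tri> _ _ ()
        onto′ (suc j) 1+j≤1+r | tri> _ _ i<1+j with i ≟ j
        ... | yes i≡j = z , trans (split-at-z c) (cong suc i≡j)
        ... | no  i≢j = let (x , cx≡j) = onto j (s≤s⁻¹ 1+j≤1+r)
                            i<cx = subst (i <_) (sym cx≡j) (≤∧≢⇒< (s≤s⁻¹ i<1+j) i≢j) in
          x , trans (lift (other {c} (λ e → <⇒≢ i<cx (sym e))) i<cx) (cong suc cx≡j)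

        admissible′ : Admissible (suc r) (split c)
        admissible′ = record
          { onto       = onto′
          ; zero-on    = λ x x∈Z → trans (keep (in-Z-other x∈Z) (subst (_≤ i) (sym (zero-on x x∈Z)) z≤n)) (zero-on x x∈Z)
          ; positive   = positive′
          ; descending = descending′ }
          where
          positive′ : ∀ x → ¬ Z x → 0 < split c x
          positive′ x x∉Z with at-or-off-z x
          ... | inj₁ refl = subst (0 <_) (sym (split-at-z c)) z<s
          ... | inj₂ x≢z  = subst (0 <_) (sym (split-off-z c x≢z)) (<-≤-trans (positive x x∉Z) (bump-inflationary i (c x)))
          descending′ : ∀ x y → parent y ≡ just x → ¬ Z x → ¬ Z y → split c y < split c x
          descending′ x y py x∉Z y∉Z with at-or-off-z x | at-or-off-z y
          ... | inj₁ refl | _         = contradiction (proj₂ z-minimal y py) y∉Z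
          ... | inj₂ x≢z  | inj₁ refl = let i<cx = descending x z py x∉Z z∉Z in
            subst₂ _<_ (sym (split-at-z c)) (sym (lift x≢z i<cx)) (s<s i<cx)
          ... | inj₂ x≢z  | inj₂ y≢z  = subst₂ _<_ (sym (split-off-z c y≢z)) (sym (split-off-z c x≢z))
                                               (bump-mono i (descending x y py x∉Z y∉Z))

        alone′ : Alone (split c)
        alone′ x x≢z e = bump-fresh i (c x) (trans (sym (split-off-z c x≢z)) (trans e (split-at-z c)))

        high′ : 2 ≤ split c z
        high′ = subst (2 ≤_) (sym (split-at-z c)) (s≤s 0<i)

      module MergeFacts {r c} (c<2+r : Bounded (suc (suc r)) c) (adm : Admissible (suc r) c)
                        (alone : Alone c) (2≤I : 2 ≤ c z) where
        open Admissible adm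

        I i : ℕ
        I = c z
        i = pred I

        0<I : 0 < I
        0<I = ≤-trans (s≤s z≤n) 2≤I

        1+i≡I : suc i ≡ I
        1+i≡I = suc-pred-pos 0<I

        keep : ∀ {x} → x ≢ z → c x ≤ I → merge c x ≡ c x
        keep x≢z le = trans (merge-off-z c x≢z) (unbump-low le)

        lower : ∀ {x} → x ≢ z → I < c x → merge c x ≡ pred (c x)
        lower x≢z lt = trans (merge-off-z c x≢z) (unbump-high lt)

        bounded′ : Bounded (suc r) (merge c)
        bounded′ x with at-or-off-z x
        ... | inj₁ refl = subst (_< suc r) (sym (merge-at-z c)) (s≤s⁻¹ (subst (_< suc (suc r)) (sym 1+i≡I) (c<2+r z)))
        ... | inj₂ x≢z  = subst (_< suc r) (sym (merge-off-z c x≢z))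
                                (unbump-bounded (alone x x≢z) (s≤s⁻¹ (c<2+r z)) (c<2+r x))

        onto′ : ∀ j → j ≤ r → ∃[ x ] merge c x ≡ j
        onto′ j j≤r with <-cmp j i
        ... | tri< j<i _ _ = let (x , cx≡j) = onto j (m≤n⇒m≤1+n j≤r)
                                 cx<I = subst₂ _<_ (sym cx≡j) 1+i≡I (m<n⇒m<1+n j<i) in
          x , trans (keep (other {c} (<⇒≢ cx<I)) (<⇒≤ cx<I)) cx≡j
        ... | tri≈ _ j≡i _ = z , trans (merge-at-z c) (sym j≡i)
        ... | tri> _ _ i<j = let (x , cx≡1+j) = onto (suc j) (s≤s j≤r)
                                 I<cx = subst₂ _<_ 1+i≡I (sym cx≡1+j) (s<s i<j) in
          x , trans (lower (other {c} (λ e → <⇒≢ I<cx (sym e))) I<cx) (cong pred cx≡1+j)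

        admissible′ : Admissible r (merge c)
        admissible′ = record
          { onto       = onto′
          ; zero-on    = λ x x∈Z → trans (keep (in-Z-other x∈Z) (subst (_≤ I) (sym (zero-on x x∈Z)) z≤n)) (zero-on x x∈Z)
          ; positive   = positive′
          ; descending = descending′ }
          where
          positive′ : ∀ x → ¬ Z x → 0 < merge c x
          positive′ x x∉Z with at-or-off-z x
          ... | inj₁ refl = subst (0 <_) (sym (merge-at-z c)) (pred-strict (s≤s z≤n) 2≤I)
          ... | inj₂ x≢z  = subst (0 <_) (sym (merge-off-z c x≢z)) (unbump-positive 0<I (positive x x∉Z))
          descending′ : ∀ x y → parent y ≡ just x → ¬ Z x → ¬ Z y → merge c y < merge c x
          descending′ x y py x∉Z y∉Z with at-or-off-z x | at-or-off-z y
          ... | inj₁ refl | _         = contradiction (proj₂ z-minimal y py) y∉Z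
          ... | inj₂ x≢z  | inj₁ refl = let I<cx = descending x z py x∉Z z∉Z in
            subst₂ _<_ (sym (merge-at-z c)) (sym (lower x≢z I<cx)) (pred-strict 0<I I<cx)
          ... | inj₂ x≢z  | inj₂ y≢z  = subst₂ _<_ (sym (merge-off-z c y≢z)) (sym (merge-off-z c x≢z))
                 (unbump-mono I (descending x y py x∉Z y∉Z) (alone y y≢z) (alone x x≢z))

        -- (the colour class i = I - 1 is nonempty, and z joins it)
        shared′ : Shared (merge c)
        shared′ = let (x , cx≡i) = onto i (<⇒≤ (s≤s⁻¹ (subst (_< suc (suc r)) (sym 1+i≡I) (c<2+r z))))
                      i<I = subst (i <_) 1+i≡I (n<1+n i)
                      x≢z = other {c} (λ e → <⇒≢ i<I (trans (sym cx≡i) e)) in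
          x , x≢z , trans (keep x≢z (subst (_≤ I) (sym cx≡i) (<⇒≤ i<I))) (trans cx≡i (sym (merge-at-z c)))

      good-resp : ∀ r {c c′} → c ≐ c′ → Good r c → Good r c′
      good-resp r e (a , w) = admissible-resp r e a , W-resp e w

      alone-resp : ∀ {c c′} → c ≐ c′ → Alone c → Alone c′
      alone-resp e alone x x≢z eq = alone x x≢z (trans (e x) (trans eq (sym (e z))))

      classify : ∀ r c → Good r c →
        (ZShares r c × ¬ ZAloneHigh r c × ¬ ZAloneAtOne r c) ⊎
        (¬ ZShares r c × ZAloneHigh r c × ¬ ZAloneAtOne r c) ⊎
        (¬ ZShares r c × ¬ ZAloneHigh r c × ZAloneAtOne r c)
      classify r c good with any? (λ x → ¬? (x ≟F z) ×-dec (c x ≟ c z))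
      ... | yes sh@(x , x≢z , same) =
        inj₁ ((good , sh) , (λ (_ , al , _) → al x x≢z same) , (λ (_ , al , _) → al x x≢z same))
      ... | no ¬sh with c z ≟ 1
      ...   | yes cz≡1 = inj₂ (inj₂ ((λ (_ , sh) → ¬sh sh) , (λ (_ , _ , 2≤cz) → <⇒≢ 2≤cz (sym cz≡1))
                                    , (good , unshared⇒alone ¬sh , cz≡1)))
      ...   | no  cz≢1 = inj₂ (inj₁ ((λ (_ , sh) → ¬sh sh) , (good , unshared⇒alone ¬sh , 2≤cz) , (λ (_ , _ , cz≡1) → cz≢1 cz≡1)))
        where 2≤cz : 2 ≤ c z
              2≤cz = ≤∧≢⇒< (Admissible.positive (proj₁ good) z z∉Z) (λ 1≡cz → cz≢1 (sym 1≡cz))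

      count-partition : ∀ r → count (suc r) (good? r)
        ≡ count (suc r) (zShares? r) + count (suc r) (zAloneHigh? r) + count (suc r) (zAloneAtOne? r)
      count-partition r = trans
        (sumL-cong (λ c → 𝟙-partition (good? r ⟦ c ⟧) (zShares? r ⟦ c ⟧) (zAloneHigh? r ⟦ c ⟧) (zAloneAtOne? r ⟦ c ⟧)
                                       proj₁ proj₁ proj₁ (classify r ⟦ c ⟧)) fs)
        (trans (sumL-+ _ _ fs) (cong (_+ count (suc r) (zAloneAtOne? r)) (sumL-+ _ _ fs)))
        where fs = allFuns v (suc r)

      -- If W is preserved by split and merge, then split and merge are
      -- inverse bijections between the classes ZShares r and ZAloneHigh (r+1),
      -- so only the colourings with z alone at colour 1 survive in the signed count.
      module Cancellation (W-split : ∀ r c → ZShares r c → W (split c))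
                          (W-merge : ∀ r c → ZAloneHigh (suc r) c → W (merge c)) where

        split-correspondence : ∀ r → Correspondence (suc r) (suc (suc r)) (ZShares r) (ZAloneHigh (suc r))
        split-correspondence r = record
          { to        = split
          ; from      = merge
          ; to-cong   = split-cong
          ; from-cong = merge-cong
          ; P-resp    = λ e (good , x , x≢z , same) → good-resp r e good , x , x≢z , trans (sym (e x)) (trans same (e z))
          ; Q-resp    = λ e (good , alone , 2≤cz) → good-resp (suc r) e good , alone-resp e alone , subst (2 ≤_) (e z) 2≤cz
          ; to-maps   = λ c bnd zs@((adm , _) , shared) → let open SplitFacts bnd adm shared in
                          bounded′ , (admissible′ , W-split r c zs) , alone′ , high′
          ; from-maps = λ c bnd zh@((adm , _) , alone , 2≤cz) → let open MergeFacts bnd adm alone 2≤cz in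
                          bounded′ , (admissible′ , W-merge r c zh) , shared′
          ; from∘to   = λ c _ _ → merge-split c
          ; to∘from   = λ c _ ((adm , _) , alone , _) → split-merge c alone (Admissible.positive adm z z∉Z) }

        -- No boundary terms: at length 0 the colour of z is < 2, and there is no
        -- admissible colouring of length v.
        cancellation : alt (λ r → + count (suc r) (good? r)) (suc v) ≡ alt (λ r → + count (suc r) (zAloneAtOne? r)) (suc v)
        cancellation = alt-cancel
          (λ r → count (suc r) (good? r)) (λ r → count (suc r) (zShares? r))
          (λ r → count (suc r) (zAloneHigh? r)) (λ r → count (suc r) (zAloneAtOne? r)) v
          count-partition
          (λ r → count-correspondence (zShares? r) (zAloneHigh? (suc r)) (split-correspondence r))
          (count-zero 1 (zAloneHigh? 0) λ c bnd (_ , _ , 2≤cz) → <⇒≱ (bnd z) (≤-trans (s≤s z≤n) 2≤cz))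
          (count-zero (suc v) (zShares? v) λ c _ ((adm , _) , _) → <-irrefl refl (length-bound adm))

  -- Peeling a minimal vertex z: the colourings where z is alone at colour 1
  -- are, after lowering every colour by one, the admissible colourings for
  -- the zero set Z ∪ {z}; hence the signed count changes sign.
  module Peel (Z : Fin v → Set) (Z? : Decidable Z) (inhabited : ∃ Z) (z : Fin v) (z-minimal : Minimal Z z) where

    Z′ : Fin v → Set
    Z′ x = Z x ⊎ x ≡ z

    Z′? : Decidable Z′
    Z′? x = Z? x ⊎-dec (x ≟F z)

    open ZeroSet Z Z?
    module Z′ = ZeroSet Z′ Z′?
    open Involution z z-minimal (λ _ → ⊤) (λ _ → yes tt) (λ _ _ → tt)

    lower : Colouring v → Colouring v
    lower c x = pred (c x)

    raise : Colouring v → Colouring v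
    raise d x with Z? x
    ... | yes _ = 0
    ... | no  _ = suc (d x)

    raise-in : ∀ d {x} → Z x → raise d x ≡ 0
    raise-in d {x} x∈Z with Z? x
    ... | yes _   = refl
    ... | no  x∉Z = contradiction x∈Z x∉Z

    raise-out : ∀ d {x} → ¬ Z x → raise d x ≡ suc (d x)
    raise-out d {x} x∉Z with Z? x
    ... | yes x∈Z = contradiction x∈Z x∉Z
    ... | no  _   = refl

    outside-Z′ : ∀ {x} → ¬ Z x → x ≢ z → ¬ Z′ x
    outside-Z′ x∉Z x≢z (inj₁ x∈Z) = x∉Z x∈Z
    outside-Z′ x∉Z x≢z (inj₂ x≡z) = x≢z x≡z

    lower-admissible : ∀ r c → Bounded (suc (suc r)) c → ZAloneAtOne (suc r) c →
      Bounded (suc r) (lower c) × Z′.Admissible r (lower c)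
    lower-admissible r c c<2+r ((adm , _) , alone , cz≡1) =
      (λ x → s≤s (pred-mono-≤ (s≤s⁻¹ (c<2+r x)))) , record
      { onto       = λ j j≤r → let (x , cx≡1+j) = onto (suc j) (s≤s j≤r) in x , cong pred cx≡1+j
      ; zero-on    = λ { x (inj₁ x∈Z) → cong pred (zero-on x x∈Z) ; x (inj₂ refl) → cong pred cz≡1 }
      ; positive   = λ x x∉Z′ → pred-strict z<s (≤∧≢⇒< (positive x (λ x∈Z → x∉Z′ (inj₁ x∈Z)))
                                   (λ 1≡cx → alone x (λ x≡z → x∉Z′ (inj₂ x≡z)) (trans (sym 1≡cx) (sym cz≡1))))
      ; descending = λ x y py x∉Z′ y∉Z′ → pred-strict (positive y (λ y∈Z → y∉Z′ (inj₁ y∈Z)))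
                                   (descending x y py (λ x∈Z → x∉Z′ (inj₁ x∈Z)) (λ y∈Z → y∉Z′ (inj₁ y∈Z))) }
      where open Admissible adm

    raise-admissible : ∀ r d → Bounded (suc r) d → Z′.Admissible r d →
      Bounded (suc (suc r)) (raise d) × ZAloneAtOne (suc r) (raise d)
    raise-admissible r d d<1+r adm′ = bounded , (admissible , tt) , alone , raise-z
      where
      open Z′.Admissible adm′
      raise-z : raise d z ≡ 1
      raise-z = trans (raise-out d z∉Z) (cong suc (zero-on z (inj₂ refl)))
      bounded : Bounded (suc (suc r)) (raise d)
      bounded x with Z? x
      ... | yes _ = z<s
      ... | no  _ = s<s (d<1+r x)
      onto′ : ∀ j → j ≤ suc r → ∃[ x ] raise d x ≡ j
      onto′ zero    _       = proj₁ inhabited , raise-in d (proj₂ inhabited)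
      onto′ (suc j) 1+j≤1+r with onto j (s≤s⁻¹ 1+j≤1+r)
      ... | x , dx≡j with Z? x
      ...   | yes x∈Z = z , trans raise-z (cong suc (trans (sym (zero-on x (inj₁ x∈Z))) dx≡j))
      ...   | no  x∉Z = x , trans (raise-out d x∉Z) (cong suc dx≡j)
      descending′ : ∀ x y → parent y ≡ just x → ¬ Z x → ¬ Z y → raise d y < raise d x
      descending′ x y py x∉Z y∉Z with at-or-off-z x | at-or-off-z y
      ... | inj₁ refl | _         = contradiction (proj₂ z-minimal y py) y∉Z
      ... | inj₂ x≢z  | inj₁ refl = subst₂ _<_ (sym raise-z) (sym (raise-out d x∉Z)) (s<s (positive x (outside-Z′ x∉Z x≢z)))
      ... | inj₂ x≢z  | inj₂ y≢z  = subst₂ _<_ (sym (raise-out d y∉Z)) (sym (raise-out d x∉Z))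
                                      (s<s (descending x y py (outside-Z′ x∉Z x≢z) (outside-Z′ y∉Z y≢z)))
      admissible : Admissible (suc r) (raise d)
      admissible = record
        { onto       = onto′
        ; zero-on    = λ x x∈Z → raise-in d x∈Z
        ; positive   = λ x x∉Z → subst (0 <_) (sym (raise-out d x∉Z)) z<s
        ; descending = descending′ }
      alone : Alone (raise d)
      alone x x≢z same with Z? x
      ... | yes _   = 0≢1+n (trans same raise-z)
      ... | no  x∉Z = <⇒≢ (positive x (outside-Z′ x∉Z x≢z)) (sym (suc-injective (trans same raise-z)))

    lower-correspondence : ∀ r → Correspondence (suc (suc r)) (suc r) (ZAloneAtOne (suc r)) (Z′.Admissible r)
    lower-correspondence r = record
      { to        = lower
      ; from      = raise
      ; to-cong   = λ e x → cong pred (e x)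
      ; from-cong = λ {d} {d′} e x → raise-cong e x
      ; P-resp    = λ e (good , alone , cz≡1) → good-resp (suc r) e good , alone-resp e alone , trans (sym (e z)) cz≡1
      ; Q-resp    = Z′.admissible-resp r
      ; to-maps   = lower-admissible r
      ; from-maps = raise-admissible r
      ; from∘to   = λ c _ ((adm , _) , _) x → raise-lower c adm x
      ; to∘from   = λ d _ adm′ x → lower-raise d adm′ x }
      where
      raise-cong : ∀ {d d′} → d ≐ d′ → raise d ≐ raise d′
      raise-cong e x with Z? x
      ... | yes _ = refl
      ... | no  _ = cong suc (e x)
      raise-lower : ∀ c → Admissible (suc r) c → raise (lower c) ≐ c
      raise-lower c adm x with Z? x
      ... | yes x∈Z = sym (Admissible.zero-on adm x x∈Z)
      ... | no  x∉Z = suc-pred-pos (Admissible.positive adm x x∉Z)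
      lower-raise : ∀ d → Z′.Admissible r d → lower (raise d) ≐ d
      lower-raise d adm′ x with Z? x
      ... | yes x∈Z = sym (Z′.Admissible.zero-on adm′ x (inj₁ x∈Z))
      ... | no  _   = refl

    peel : signedCount ≡ - Z′.signedCount
    peel = begin
      alt (λ r → + count (suc r) (admissible? r)) (suc v)
        ≡⟨ alt-cong (suc v) (λ r → cong +_ (count-cong (suc r) (admissible? r) (good? r) (λ _ _ a → a , tt) (λ _ _ → proj₁))) ⟩
      alt (λ r → + count (suc r) (good? r)) (suc v)
        ≡⟨ Cancellation.cancellation (λ _ _ _ → tt) (λ _ _ _ → tt) ⟩
      + count 1 (zAloneAtOne? 0) - alt (λ r → + count (suc (suc r)) (zAloneAtOne? (suc r))) v
        ≡⟨ cong₂ (λ s t → + s - t)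
             (count-zero 1 (zAloneAtOne? 0) (λ c bnd (_ , _ , cz≡1) → <⇒≢ (bnd z) cz≡1))
             (alt-cong v (λ r → cong +_ (count-correspondence (zAloneAtOne? (suc r)) (Z′.admissible? r) (lower-correspondence r)))) ⟩
      + 0 - alt (λ r → + count (suc r) (Z′.admissible? r)) v
        ≡⟨ cong (λ t → + 0 - t) (sym (alt-drop-last (λ r → + count (suc r) (Z′.admissible? r)) v
             (cong +_ (count-zero (suc v) (Z′.admissible? v) (λ _ _ adm′ → <-irrefl refl (Z′.length-bound adm′)))))) ⟩
      + 0 - Z′.signedCount
        ≡⟨ ℤP.+-identityˡ _ ⟩
      - Z′.signedCount ∎
      where open ≡-Reasoning

    outside-peel : outside ≡ suc Z′.outside
    outside-peel = begin
      ∑[ x < v ] 𝟙 (¬? (Z? x))                              ≡⟨ sum-cong-≗ {v} split-indicator ⟩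
      ∑[ x < v ] (𝟙 (¬? (Z′? x)) + 𝟙 (x ≟F z))              ≡⟨ ∑-distrib-+ (λ x → 𝟙 (¬? (Z′? x))) (λ x → 𝟙 (x ≟F z)) ⟩
      Z′.outside + ∑[ x < v ] 𝟙 (x ≟F z)                    ≡⟨ cong (λ t → Z′.outside + t) (∑-point v z) ⟩
      Z′.outside + 1                                        ≡⟨ +-comm Z′.outside 1 ⟩
      suc Z′.outside                                        ∎
      where
      open ≡-Reasoning
      split-indicator : ∀ x → 𝟙 (¬? (Z? x)) ≡ 𝟙 (¬? (Z′? x)) + 𝟙 (x ≟F z)
      split-indicator x with Z? x | x ≟F z
      ... | yes x∈Z | yes refl = contradiction x∈Z (proj₁ z-minimal)
      ... | yes _   | no  _    = refl
      ... | no  _   | yes _    = refl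
      ... | no  _   | no  _    = refl

  module AllZero (Z : Fin v → Set) (Z? : Decidable Z) (inhabited : ∃ Z) (all-Z : ∀ x → Z x) where
    open ZeroSet Z Z?

    signedCount-all-zero : signedCount ≡ + 1
    signedCount-all-zero = begin
      + count 1 (admissible? 0) - alt (λ r → + count (suc (suc r)) (admissible? (suc r))) v
        ≡⟨ cong₂ (λ s t → + s - t) only-zero (alt-zero _ v (λ r → cong +_ (none-longer r))) ⟩
      + 1 - + 0 ∎
      where
      open ≡-Reasoning
      only-zero : count 1 (admissible? 0) ≡ 1
      only-zero = trans
        (count-cong 1 (admissible? 0) (λ c → all? (λ x → c x ≟ 0))
          (λ c _ adm x → Admissible.zero-on adm x (all-Z x))
          (λ c _ c≐0 → record { onto       = λ { zero _ → proj₁ inhabited , c≐0 (proj₁ inhabited) }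
                                ; zero-on    = λ x _ → c≐0 x
                                ; positive   = λ x x∉Z → contradiction (all-Z x) x∉Z
                                ; descending = λ x _ _ x∉Z _ → contradiction (all-Z x) x∉Z }))
        (count-singleton {v} 1 (λ _ → 0) (λ _ → z<s))
      none-longer : ∀ r → count (suc (suc r)) (admissible? (suc r)) ≡ 0
      none-longer r = count-zero (suc (suc r)) (admissible? (suc r)) λ c _ adm →
        let open Admissible adm; (x , cx≡1) = onto 1 (s≤s z≤n) in
        0≢1+n (trans (sym (zero-on x (all-Z x))) cx≡1)

  -- Induction on that number, peeling off a minimal vertex outside Z.
  signed-count : ∀ k (Z : Fin v → Set) (Z? : Decidable Z) → ∃ Z →
    ZeroSet.outside Z Z? ≡ k → ZeroSet.signedCount Z Z? ≡ -1ℤ ^ k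
  signed-count k Z Z? inhabited size with all? Z?
  ... | yes all-Z = trans (AllZero.signedCount-all-zero Z Z? inhabited all-Z)
                          (cong (-1ℤ ^_) (trans (sym nothing-outside) size))
    where
    nothing-outside : ZeroSet.outside Z Z? ≡ 0
    nothing-outside = trans (sum-cong-≗ {v} (λ x → 𝟙-no (λ x∉Z → x∉Z (all-Z x)) (¬? (Z? x)))) (sum-replicate-zero v)
  ... | no not-all with ¬∀⟶∃¬ v Z Z? not-all
  ...   | x₀ , x₀∉Z with minimal-exists Z? x₀ x₀∉Z | k
  ...     | z , z-minimal | zero  = contradiction (trans (sym (Peel.outside-peel Z Z? inhabited z z-minimal)) size) λ ()
  ...     | z , z-minimal | suc k = begin
    ZeroSet.signedCount Z Z?                         ≡⟨ peel ⟩
    - ZeroSet.signedCount Z′ Z′?                     ≡⟨ cong -_ (signed-count k Z′ Z′? (proj₁ inhabited , inj₁ (proj₂ inhabited))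
                                                          (suc-injective (trans (sym outside-peel) size))) ⟩
    - (-1ℤ ^ k)                                      ≡⟨ sym (ℤP.-1*i≡-i (-1ℤ ^ k)) ⟩
    -1ℤ ^ suc k                                      ∎
    where
    open ≡-Reasoning
    open Peel Z Z? inhabited z z-minimal

module FromForest {m n : ℕ} (lab : Fin m → Fin n) (0<m : 0 < m) (F : Forest m) where
  open import Data.Nat using (suc; _+_; _∸_; _≤_; _≟_; z≤n; s≤s; s≤s⁻¹)
  open import Data.Nat.Properties using (m+n∸n≡m; <-irrefl; <⇒≢; ≤-trans; <-≤-trans; 0≢1+n; suc-injective; +-0-commutativeMonoid)
  open import Data.Fin using (toℕ; fromℕ<)
  open import Data.Fin.Properties using (all?; any?; toℕ<n; toℕ-fromℕ<; toℕ-injective; ¬∀⟶∃¬) renaming (_≟_ to _≟F_)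
  open import Data.Maybe.Properties using (≡-dec)
  open import Data.Product using (∃; ∃-syntax; proj₂)
  open import Data.Sum using (_⊎_; inj₁; inj₂)
  open import Relation.Binary.PropositionalEquality
  open import Relation.Nullary using (Dec; yes; no; contradiction)
  open import Relation.Nullary.Decidable using (_×-dec_; _⊎-dec_; _→-dec_; ¬?)
  open import Relation.Unary using (Decidable)
  open import Data.List using (length; filter)
  open import Algebra.Properties.CommutativeMonoid.Sum +-0-commutativeMonoid using (sum-syntax; sum-cong-≗; sum-replicate-zero; ∑-distrib-+; ∑-comm)
  open Counting
  open AlternatingSums
  open Recolouring

  open Forest F
  open ForestColourings parent acyclic

  Leaf : Fin v → Set
  Leaf = IsLeaf parent

  leaf? : Decidable Leaf
  leaf? = isLeaf? lab F

  open ZeroSet Leaf leaf?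

  some-leaf : ∃ Leaf
  some-leaf = leafOf (fromℕ< 0<m) , leafOf-leaf (fromℕ< 0<m)

  leaf-count : ∑[ x < v ] 𝟙 (leaf? x) ≡ m
  leaf-count = begin
    ∑[ x < v ] 𝟙 (leaf? x)                          ≡⟨ sum-cong-≗ {v} labels-of ⟩
    ∑[ x < v ] ∑[ a < m ] 𝟙 (leafOf a ≟F x)        ≡⟨ ∑-comm (λ x a → 𝟙 (leafOf a ≟F x)) ⟩
    ∑[ a < m ] ∑[ x < v ] 𝟙 (leafOf a ≟F x)        ≡⟨ sum-cong-≗ {m} (λ a → trans (sum-cong-≗ {v} (λ x →
                                                         𝟙-cong sym sym (leafOf a ≟F x) (x ≟F leafOf a))) (∑-point v (leafOf a))) ⟩
    ∑[ a < m ] 1                                    ≡⟨ ∑-const-1 m ⟩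
    m                                               ∎
    where
    open ≡-Reasoning
    labels-of : ∀ x → 𝟙 (leaf? x) ≡ ∑[ a < m ] 𝟙 (leafOf a ≟F x)
    labels-of x with leaf? x
    ... | no ¬leaf = sym (trans (sum-cong-≗ {m} (λ a → 𝟙-no (λ e → ¬leaf (subst Leaf e (leafOf-leaf a))) (leafOf a ≟F x)))
                                (sum-replicate-zero m))
    ... | yes leaf with leafOf-onto x leaf
    ...   | a₀ , a₀↦x = sym (trans (sum-cong-≗ {m} (λ a → 𝟙-cong (λ e → leafOf-inj a a₀ (trans e (sym a₀↦x)))
                                                               (λ e → trans (cong leafOf e) a₀↦x)
                                                               (leafOf a ≟F x) (a ≟F a₀)))
                                   (∑-point m a₀))

  outside≡w : outside ≡ w lab F
  outside≡w = begin
    outside                                   ≡⟨ sym (m+n∸n≡m outside m) ⟩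
    outside + m ∸ m                           ≡⟨ cong (λ t → outside + t ∸ m) (sym leaf-count) ⟩
    outside + ∑[ x < v ] 𝟙 (leaf? x) ∸ m      ≡⟨ cong (_∸ m) (sym (∑-distrib-+ (λ x → 𝟙 (¬? (leaf? x))) (λ x → 𝟙 (leaf? x)))) ⟩
    ∑[ x < v ] (𝟙 (¬? (leaf? x)) + 𝟙 (leaf? x)) ∸ m ≡⟨ cong (_∸ m) (trans (sum-cong-≗ {v} one) (∑-const-1 v)) ⟩
    v ∸ m                                     ∎
    where
    open ≡-Reasoning
    one : ∀ x → 𝟙 (¬? (leaf? x)) + 𝟙 (leaf? x) ≡ 1
    one x with leaf? x
    ... | yes _ = refl
    ... | no  _ = refl

  WeaklyMixingℕ : Colouring v → Set
  WeaklyMixingℕ c = (∃[ x ] (c x ≡ 1 × MixedChildren lab F x)) ⊎ (∀ x → c x ≢ 1)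

  weaklyMixing? : Decidable WeaklyMixingℕ
  weaklyMixing? c = any? (λ x → (c x ≟ 1) ×-dec mixedChildren? lab F x) ⊎-dec all? (λ x → ¬? (c x ≟ 1))

  weaklyMixing-resp : ∀ {c c′} → c ≐ c′ → WeaklyMixingℕ c → WeaklyMixingℕ c′
  weaklyMixing-resp e (inj₁ (x , cx≡1 , mixed)) = inj₁ (x , trans (sym (e x)) cx≡1 , mixed)
  weaklyMixing-resp e (inj₂ no-1)               = inj₂ (λ x c′x≡1 → no-1 x (trans (e x) c′x≡1))

  -- A colouring is in 𝒞_F iff it is admissible for the leaves and weakly mixing
  -- (positivity off the leaves comes from reducedness: inner vertices have children).
  inC⇒admissible : ∀ r (c : Fin v → Fin (suc r)) → InC lab F r c → Admissible r ⟦ c ⟧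
  inC⇒admissible r c (gap-free , leaves-zero , decreasing , _) = record
    { onto       = λ j j≤r → let (x , cx≡j) = gap-free (fromℕ< (s≤s j≤r)) in
                     x , trans (cong toℕ cx≡j) (toℕ-fromℕ< (s≤s j≤r))
    ; zero-on    = leaves-zero
    ; positive   = λ x inner → let (y , _ , _ , py , _) = reduced x inner in
                     ≤-trans (s≤s z≤n) (decreasing x y py)
    ; descending = λ x y py _ _ → decreasing x y py }

  admissible⇒inC : ∀ r (c : Fin v → Fin (suc r)) → Admissible r ⟦ c ⟧ → WeaklyMixingℕ ⟦ c ⟧ → InC lab F r c
  admissible⇒inC r c adm wm = gap-free , zero-on , decreasing , wm
    where
    open Admissible adm
    gap-free : GapFree lab F r c
    gap-free j = let (x , cx≡j) = onto (toℕ j) (s≤s⁻¹ (toℕ<n j)) in x , toℕ-injective cx≡j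
    decreasing : Decreasing lab F r c
    decreasing x y py with leaf? y
    ... | yes leaf = subst (_< toℕ (c x)) (sym (zero-on y leaf)) (positive x (λ x-leaf → x-leaf y py))
    ... | no inner = descending x y py (λ x-leaf → x-leaf y py) inner

  signedSum-as-alt : ∀ {P : ℕ → Colouring v → Set} (P? : ∀ r → Decidable (P r)) →
    (∀ r (c : Fin v → Fin (suc r)) → InC lab F r c → P r ⟦ c ⟧) →
    (∀ r (c : Fin v → Fin (suc r)) → P r ⟦ c ⟧ → InC lab F r c) →
    signedSum lab F ≡ alt (λ r → + count (suc r) (P? r)) (suc v)
  signedSum-as-alt P? to from = begin
    signedSum lab F
      ≡⟨ sum-signed≡alt (λ r → + length (filter (inC? lab F r) (allFuns v (suc r)))) (suc v) ⟩
    alt (λ r → + length (filter (inC? lab F r) (allFuns v (suc r)))) (suc v)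
      ≡⟨ alt-cong (suc v) (λ r → cong +_ (trans (length-filter (inC? lab F r) (allFuns v (suc r))) (same-count r))) ⟩
    alt (λ r → + count (suc r) (P? r)) (suc v) ∎
    where
    open ≡-Reasoning
    same-count : ∀ r → sumL (λ c → 𝟙 (inC? lab F r c)) (allFuns v (suc r)) ≡ count (suc r) (P? r)
    same-count r = sumL-cong (λ c → 𝟙-cong (to r c) (from r c) (inC? lab F r c) (P? r ⟦ c ⟧)) (allFuns v (suc r))

  -- If F is mixing, every admissible colouring is weakly mixing: a vertex of
  -- colour 1 is an inner vertex all of whose children are leaves.
  mixing⇒weaklyMixing : Mixing lab F → ∀ {r} c → Admissible r c → WeaklyMixingℕ c
  mixing⇒weaklyMixing mixing c adm with any? (λ x → c x ≟ 1)
  ... | no  none         = inj₂ (λ x cx≡1 → none (x , cx≡1))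
  ... | yes (x , cx≡1) = inj₁ (x , cx≡1 , mixing x inner leaf-children)
    where
    open Admissible adm
    inner : ¬ Leaf x
    inner leaf = 0≢1+n (trans (sym (zero-on x leaf)) cx≡1)
    leaf-children : ∀ y → parent y ≡ just x → Leaf y
    leaf-children y py with leaf? y
    ... | yes leaf    = leaf
    ... | no  inner-y = contradiction
      (<-≤-trans (positive y inner-y) (s≤s⁻¹ (subst (c y <_) cx≡1 (descending x y py inner inner-y)))) (<-irrefl refl)

  -- Mixing case: 𝒞_F is the set of leaf-admissible colourings.
  mixing-case : Mixing lab F → signedSum lab F ≡ -1ℤ ^ w lab F
  mixing-case mixing = begin
    signedSum lab F  ≡⟨ signedSum-as-alt admissible? (λ r c inC → inC⇒admissible r c inC)
                                         (λ r c adm → admissible⇒inC r c adm (mixing⇒weaklyMixing mixing ⟦ c ⟧ adm)) ⟩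
    signedCount      ≡⟨ signed-count outside Leaf leaf? some-leaf refl ⟩
    -1ℤ ^ outside    ≡⟨ cong (-1ℤ ^_) outside≡w ⟩
    -1ℤ ^ w lab F    ∎
    where open ≡-Reasoning

  -- An inner vertex z with only leaf children which are not mixed: split and
  -- merge at z preserve weak mixing, and no weakly mixing colouring has z
  -- alone at colour 1, so everything cancels.
  module Unmixed (z : Fin v) (z-minimal : Minimal Leaf z) (unmixed : ¬ MixedChildren lab F z) where
    open Involution z z-minimal WeaklyMixingℕ weaklyMixing? weaklyMixing-resp

    -- A colour-1 vertex with mixed children is not z and keeps colour 1 under split
    -- and merge; absence of colour 1 persists under split and is impossible for
    -- colourings of length ≥ 1.
    split-weaklyMixing : ∀ r c → ZShares r c → WeaklyMixingℕ (split c)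
    split-weaklyMixing r c ((adm , inj₁ (x , cx≡1 , mixed)) , _) =
      inj₁ (x , trans (split-off-z c x≢z) (trans (bump-low (subst (_≤ c z) (sym cx≡1) (Admissible.positive adm z z∉Z))) cx≡1) , mixed)
      where x≢z : x ≢ z
            x≢z refl = unmixed mixed
    split-weaklyMixing r c ((adm , inj₂ no-1) , _) = inj₂ no-1′
      where
      no-1′ : ∀ x → split c x ≢ 1
      no-1′ x e with at-or-off-z x
      ... | inj₁ refl = <⇒≢ (Admissible.positive adm z z∉Z) (sym (suc-injective (trans (sym (split-at-z c)) e)))
      ... | inj₂ x≢z  = no-1 x (bump-one (trans (sym (split-off-z c x≢z)) e))

    merge-weaklyMixing : ∀ r c → ZAloneHigh (suc r) c → WeaklyMixingℕ (merge c)
    merge-weaklyMixing r c ((adm , inj₁ (x , cx≡1 , mixed)) , _ , 2≤cz) =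
      inj₁ (x , trans (merge-off-z c x≢z) (trans (unbump-low (subst (_≤ c z) (sym cx≡1) (≤-trans (s≤s z≤n) 2≤cz))) cx≡1) , mixed)
      where x≢z : x ≢ z
            x≢z refl = <⇒≢ 2≤cz (sym cx≡1)
    merge-weaklyMixing r c ((adm , inj₂ no-1) , _) =
      let (x , cx≡1) = Admissible.onto adm 1 (s≤s z≤n) in contradiction cx≡1 (no-1 x)

    -- If z alone has colour 1, weak mixing would need z to have mixed children.
    no-zAloneAtOne : ∀ r c → ¬ ZAloneAtOne r c
    no-zAloneAtOne r c ((_ , inj₁ (x , cx≡1 , mixed)) , alone , cz≡1) with at-or-off-z x
    ... | inj₁ refl = unmixed mixed
    ... | inj₂ x≢z  = alone x x≢z (trans cx≡1 (sym cz≡1))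
    no-zAloneAtOne r c ((_ , inj₂ no-1) , _ , cz≡1) = no-1 z cz≡1

    signedSum-vanishes : signedSum lab F ≡ + 0
    signedSum-vanishes = begin
      signedSum lab F
        ≡⟨ signedSum-as-alt good? (λ r c inC → inC⇒admissible r c inC , proj₂ (proj₂ (proj₂ inC)))
                                  (λ r c (adm , wm) → admissible⇒inC r c adm wm) ⟩
      alt (λ r → + count (suc r) (good? r)) (suc v)
        ≡⟨ Cancellation.cancellation split-weaklyMixing merge-weaklyMixing ⟩
      alt (λ r → + count (suc r) (zAloneAtOne? r)) (suc v)
        ≡⟨ alt-zero _ (suc v) (λ r → cong +_ (count-zero (suc r) (zAloneAtOne? r) (λ c _ → no-zAloneAtOne r c))) ⟩
      + 0 ∎
      where open ≡-Reasoning

  -- If F is not mixing, some inner vertex with only leaf children is unmixed.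
  non-mixing-case : ¬ Mixing lab F → signedSum lab F ≡ + 0
  non-mixing-case not-mixing with ¬∀⟶∃¬ v _ mixing-at? not-mixing
    where
    mixing-at? : ∀ x → Dec (¬ Leaf x → (∀ y → parent y ≡ just x → Leaf y) → MixedChildren lab F x)
    mixing-at? x = ¬? (leaf? x) →-dec (all? (λ y → ≡-dec _≟F_ (parent y) (just x) →-dec leaf? y) →-dec mixedChildren? lab F x)
  ... | z , fails = Unmixed.signedSum-vanishes z (inner , leaf-children) unmixed
    where
    inner : ¬ Leaf z
    inner leaf = fails (λ inner → contradiction leaf inner)
    leaf-children : ∀ y → parent y ≡ just z → Leaf y
    leaf-children y py with leaf? y
    ... | yes leaf    = leaf
    ... | no  inner-y = contradiction (λ _ children → contradiction (children y py) inner-y) fails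
    unmixed : ¬ MixedChildren lab F z
    unmixed mixed = fails (λ _ _ → mixed)

proposition1p22 : (m n : ℕ) (lab : Fin m → Fin n) → 0 < m → (F : Forest m) →
    (Mixing lab F → signedSum lab F ≡ -1ℤ ^ w lab F)
    × (¬ Mixing lab F → signedSum lab F ≡ + 0)
proposition1p22 m n lab 0<m F = mixing-case , non-mixing-case
  where open FromForest lab 0<m F
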